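{- Let $p$ be an odd prime, $g$ a generator of $\mathbb{Z}_p^*$, and $x$ an integer with $0<x<p-1$. Then $g^x\in\mathcal{NI}(g)$ if and only if $x\in B(p-1)$.
   Context: For an integer $n>0$, $B(n)=\{x\in\mathbb{Z}: 0<x<n,\ x \text{ even},\ \gcd(x-1,n)>1,\ \gcd(x+1,n)>1\}$. For an odd prime $p$: $\mathcal{G}$ is the set of generators of $\mathbb{Z}_p^*$, $\mathcal{R}$ the set of quadratic residues in $\mathbb{Z}_p^*$, $\mathcal{NG}$ the set of quadratic non-residues that are not generators. For $g\in\mathcal{G}$: $\bar{\mathcal{R}}_g=\{r\in\mathcal{R}: gr\in\mathcal{NG}\}$ and $\mathcal{NI}(g)=\bar{\mathcal{R}}_g\cap\bar{\mathcal{R}}_{g^{ -1}}$ (products mod $p$). -}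

module Defs where

open import Data.Nat using (ℕ; suc; _+_; _*_; _∸_; _^_; _<_; _≤_; NonZero)
open import Data.Nat.DivMod using (_%_)
open import Data.Nat.GCD using (gcd)
open import Data.Nat.Primality using (Prime)
open import Data.Product using (_×_; ∃-syntax)
open import Relation.Binary.PropositionalEquality using (_≡_)
open import Relation.Nullary using (¬_)

-- B(n) = { x : 0 < x < n, x even, gcd(x-1,n) > 1, gcd(x+1,n) > 1 }
-- (x > 0, so x ∸ 1 is the true x - 1)
B : ℕ → ℕ → Set
B n x = 0 < x × x < n × (∃[ k ] x ≡ 2 * k) × 1 < gcd (x ∸ 1) n × 1 < gcd (x + 1) n

-- elements of Z_p^* represented by their canonical residues 1 .. p-1
Unit : ℕ → ℕ → Set
Unit p a = 0 < a × a < p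

module _ (p : ℕ) .{{_ : NonZero p}} where

  IsGenerator : ℕ → Set
  IsGenerator g = Unit p g × (∀ a → Unit p a → ∃[ k ] g ^ k % p ≡ a)

  IsQR : ℕ → Set
  IsQR r = Unit p r × ∃[ y ] (y * y) % p ≡ r

  IsNG : ℕ → Set
  IsNG a = Unit p a × ¬ IsQR a × ¬ IsGenerator a

  Rbar : ℕ → ℕ → Set
  Rbar g r = IsQR r × IsNG ((g * r) % p)

  IsInverse : ℕ → ℕ → Set
  IsInverse g h = Unit p h × (g * h) % p ≡ 1

  NI : ℕ → ℕ → Set
  NI g r = Rbar g r × ∃[ h ] (IsInverse g h × Rbar h r)

-- Let n = p − 1. A generator g has order exactly n: by pigeonhole some g^e with 0 < e ≤ n
-- is 1, and no 0 < e < n works because the n units are all powers of g. Hence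
-- k ↦ g^k mod p identifies exponents modulo n with units, and since n is even, g^c is a
-- quadratic residue iff c is even, and a generator iff gcd(c, n) = 1 (Bézout). As
-- g · g^x = g^(x+1) and g⁻¹ · g^x = g^(x−1), and x ± 1 is odd when x is even, g^x lies in
-- R̄_g ∩ R̄_{g⁻¹} exactly when x is even and gcd(x ± 1, n) > 1, i.e. when x ∈ B(n).

module Submission where

open import Defs
open import Data.Nat using (ℕ; _^_; _∸_; _<_; NonZero)
open import Data.Nat.DivMod using (_%_)
open import Data.Nat.Primality using (Prime)
open import Data.Product using (_×_)
open import Relation.Binary.PropositionalEquality using (_≢_)

open import Data.Nat using (zero; suc; _+_; _*_; _≤_; z<s; s<s; s≤s⁻¹; pred; _≤?_; >-nonZero; >-nonZero⁻¹; ≢-nonZero⁻¹)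
open import Data.Nat.Properties
open import Data.Nat.DivMod hiding (_mod_)
open import Data.Nat.Divisibility
open import Data.Nat.GCD using (gcd; gcd[m,n]≢0; module Bézout)
open import Data.Nat.Coprimality using (Coprime; coprime-Bézout; coprime⇒gcd≡1; gcd≡1⇒coprime)
open import Data.Nat.Primality using (euclidsLemma; prime⇒irreducible; ¬prime[0]; ¬prime[1])
open import Data.Nat.Tactic.RingSolver using (solve-∀)
open import Data.Fin using (Fin; toℕ; fromℕ<)
open import Data.Fin.Properties using (pigeonhole; toℕ-fromℕ<; toℕ<n)
open import Data.Product using (_,_; proj₁; proj₂; ∃-syntax; ∃₂)
open import Data.Sum using (_⊎_; inj₁; inj₂; [_,_]′; swap; map₁)
open import Function using (_∘_; id)
open import Function.Bundles using (_⇔_; mk⇔; Equivalence)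
open import Relation.Binary.PropositionalEquality
open import Data.Empty using (⊥-elim)
open import Relation.Nullary using (¬_; yes; no; contradiction)

infix 4 _≡_mod_

_≡_mod_ : ℕ → ℕ → (q : ℕ) .{{_ : NonZero q}} → Set
a ≡ b mod q = a % q ≡ b % q

module _ {q : ℕ} .{{_ : NonZero q}} where
  open ≡-Reasoning

  %-≡-mod : ∀ a → a % q ≡ a mod q
  %-≡-mod a = m%n%n≡m%n a q

  *-cong-mod : ∀ {a b c d} → a ≡ b mod q → c ≡ d mod q → a * c ≡ b * d mod q
  *-cong-mod {a} {b} {c} {d} a≡b c≡d = begin
    a * c % q              ≡⟨ %-distribˡ-* a c q ⟩
    (a % q) * (c % q) % q  ≡⟨ cong₂ (λ u v → u * v % q) a≡b c≡d ⟩
    (b % q) * (d % q) % q  ≡⟨ %-distribˡ-* b d q ⟨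
    b * d % q              ∎

  ^-cong-mod : ∀ {a b} → a ≡ b mod q → ∀ k → a ^ k ≡ b ^ k mod q
  ^-cong-mod a≡b zero    = refl
  ^-cong-mod a≡b (suc k) = *-cong-mod a≡b (^-cong-mod a≡b k)

  <-≡-mod⇒≡ : ∀ {a b} → a < q → b < q → a ≡ b mod q → a ≡ b
  <-≡-mod⇒≡ a<q b<q a≡b = trans (sym (m<n⇒m%n≡m a<q)) (trans a≡b (m<n⇒m%n≡m b<q))

  ≡-mod⇒∣∸ : ∀ {a b} → a ≡ b mod q → q ∣ b ∸ a
  ≡-mod⇒∣∸ {a} {b} a≡b = divides (b / q ∸ a / q) (begin
    b ∸ a                                      ≡⟨ cong₂ _∸_ (m≡m%n+[m/n]*n b q) (m≡m%n+[m/n]*n a q) ⟩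
    (b % q + b / q * q) ∸ (a % q + a / q * q)  ≡⟨ cong (λ r → (b % q + b / q * q) ∸ (r + a / q * q)) a≡b ⟩
    (b % q + b / q * q) ∸ (b % q + a / q * q)  ≡⟨ [m+n]∸[m+o]≡n∸o (b % q) _ _ ⟩
    b / q * q ∸ a / q * q                      ≡⟨ *-distribʳ-∸ q (b / q) (a / q) ⟨
    (b / q ∸ a / q) * q                        ∎)

  ≤∧∣∸⇒≡-mod : ∀ {a b} → a ≤ b → q ∣ b ∸ a → a ≡ b mod q
  ≤∧∣∸⇒≡-mod {a} a≤b q∣b∸a = trans (sym (%-remove-+ʳ a q∣b∸a)) (cong (_% q) (m+[n∸m]≡n a≤b))

  ∣∸⇒≡-mod : ∀ {a b} → q ∣ b ∸ a → q ∣ a ∸ b → a ≡ b mod q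
  ∣∸⇒≡-mod {a} {b} q∣b∸a q∣a∸b with ≤-total a b
  ... | inj₁ a≤b = ≤∧∣∸⇒≡-mod a≤b q∣b∸a
  ... | inj₂ b≤a = sym (≤∧∣∸⇒≡-mod b≤a q∣a∸b)

  ∣-resp-≡-mod : ∀ {d a b} → d ∣ q → a ≡ b mod q → d ∣ a → d ∣ b
  ∣-resp-≡-mod d∣q a≡b d∣a = ∣n∣m%n⇒∣m d∣q (subst (_ ∣_) a≡b (%-presˡ-∣ d∣a d∣q))

  *-cancelˡ-mod : Prime q → ∀ {c a b} → ¬ q ∣ c → c * a ≡ c * b mod q → a ≡ b mod q
  *-cancelˡ-mod q-prime {c} q∤c ca≡cb =
    ∣∸⇒≡-mod (cancel (≡-mod⇒∣∸ ca≡cb)) (cancel (≡-mod⇒∣∸ (sym ca≡cb)))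
    where
    cancel : ∀ {a b} → q ∣ c * b ∸ c * a → q ∣ b ∸ a
    cancel {a} {b} q∣cb∸ca =
      [ (λ q∣c → contradiction q∣c q∤c) , id ]′
        (euclidsLemma c (b ∸ a) q-prime (subst (q ∣_) (sym (*-distribˡ-∸ c b a)) q∣cb∸ca))

  ^-mod-period : ∀ {g e} .{{_ : NonZero e}} → g ^ e ≡ 1 mod q → ∀ k → g ^ k ≡ g ^ (k % e) mod q
  ^-mod-period {g} {e} gᵉ≡1 k = begin
    g ^ k % q                                ≡⟨ cong (λ i → g ^ i % q) (m≡m%n+[m/n]*n k e) ⟩
    g ^ (k % e + k / e * e) % q              ≡⟨ cong (λ i → g ^ (k % e + i) % q) (*-comm (k / e) e) ⟩
    g ^ (k % e + e * (k / e)) % q            ≡⟨ cong (_% q) (^-distribˡ-+-* g (k % e) (e * (k / e))) ⟩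
    g ^ (k % e) * g ^ (e * (k / e)) % q      ≡⟨ cong (λ x → g ^ (k % e) * x % q) (^-*-assoc g e (k / e)) ⟨
    g ^ (k % e) * (g ^ e) ^ (k / e) % q      ≡⟨ *-cong-mod {g ^ (k % e)} refl (^-cong-mod gᵉ≡1 (k / e)) ⟩
    g ^ (k % e) * 1 ^ (k / e) % q            ≡⟨ cong (λ x → g ^ (k % e) * x % q) (^-zeroˡ (k / e)) ⟩
    g ^ (k % e) * 1 % q                      ≡⟨ cong (_% q) (*-identityʳ (g ^ (k % e))) ⟩
    g ^ (k % e) % q                          ∎

  ^-cong-exp-mod : ∀ {g e a b} .{{_ : NonZero e}} → g ^ e ≡ 1 mod q → a ≡ b mod e → g ^ a ≡ g ^ b mod q
  ^-cong-exp-mod {g} {a = a} {b} gᵉ≡1 a≡b =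
    trans (^-mod-period gᵉ≡1 a) (trans (cong (λ i → g ^ i % q) a≡b) (sym (^-mod-period gᵉ≡1 b)))

  inverse-cancelˡ-mod : ∀ {a h b} → IsInverse q a h → h * (a * b) ≡ b mod q
  inverse-cancelˡ-mod {a} {h} {b} ((0<h , h<q) , ah≡1) = begin
    h * (a * b) % q  ≡⟨ cong (_% q) (trans (sym (*-assoc h a b)) (cong (_* b) (*-comm h a))) ⟩
    a * h * b % q    ≡⟨ *-cong-mod (trans ah≡1 (sym (m<n⇒m%n≡m (≤-<-trans 0<h h<q)))) refl ⟩
    1 * b % q        ≡⟨ cong (_% q) (*-identityˡ b) ⟩
    b % q            ∎

coprime⇒solvable-mod : ∀ {c n} .{{_ : NonZero n}} → Coprime c n → ∀ k → ∃[ t ] c * t ≡ k mod n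
coprime⇒solvable-mod {c} {n@(suc m)} c⊥n k with coprime-Bézout c⊥n
... | Bézout.+- x y 1+yn≡xc = x * k , (begin
  c * (x * k) % n        ≡⟨ cong (_% n) (reassociate c x k) ⟩
  x * c * k % n          ≡⟨ cong (λ z → z * k % n) 1+yn≡xc ⟨
  (1 + y * n) * k % n    ≡⟨ cong (_% n) (expand y n k) ⟩
  (k + y * k * n) % n    ≡⟨ [m+kn]%n≡m%n k (y * k) n ⟩
  k % n                  ∎)
  where
  open ≡-Reasoning
  reassociate : ∀ c x k → c * (x * k) ≡ x * c * k
  reassociate = solve-∀
  expand : ∀ y n k → (1 + y * n) * k ≡ k + y * k * n
  expand = solve-∀
-- Here x * c ≡ −1, so x * (n − 1) inverts c modulo n.
... | Bézout.-+ x y 1+xc≡yn = x * m * k , (begin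
  c * (x * m * k) % n                ≡⟨ [m+kn]%n≡m%n (c * (x * m * k)) k n ⟨
  (c * (x * m * k) + k * n) % n      ≡⟨ cong (_% n) (collect c x m k) ⟩
  ((1 + x * c) * m * k + k) % n      ≡⟨ cong (λ z → (z * m * k + k) % n) 1+xc≡yn ⟩
  (y * n * m * k + k) % n            ≡⟨ cong (_% n) (expand y m k) ⟩
  (k + y * m * k * n) % n            ≡⟨ [m+kn]%n≡m%n k (y * m * k) n ⟩
  k % n                              ∎)
  where
  open ≡-Reasoning
  collect : ∀ c x m k → c * (x * m * k) + k * suc m ≡ (1 + x * c) * m * k + k
  collect = solve-∀
  expand : ∀ y m k → y * suc m * m * k + k ≡ k + y * m * k * suc m
  expand = solve-∀

^-double : ∀ g j → g ^ (j * 2) ≡ g ^ j * g ^ j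
^-double g j = trans (sym (^-*-assoc g j 2)) (cong (g ^ j *_) (*-identityʳ (g ^ j)))

even⊎odd : ∀ a → 2 ∣ a ⊎ 2 ∣ suc a
even⊎odd zero    = inj₁ (2 ∣0)
even⊎odd (suc a) = swap (map₁ (∣m∣n⇒∣m+n ∣-refl) (even⊎odd a))

even⇒¬even-suc : ∀ {a} → 2 ∣ a → ¬ 2 ∣ suc a
even⇒¬even-suc {a} 2∣a 2∣1+a =
  >⇒∤ (s<s z<s) (∣m+n∣m⇒∣n (subst (2 ∣_) (+-comm 1 a) 2∣1+a) 2∣a)

odd-prime⇒even-pred : ∀ {n} → Prime (suc n) → suc n ≢ 2 → 2 ∣ n
odd-prime⇒even-pred {n} p-prime p≢2 with even⊎odd n
... | inj₁ 2∣n = 2∣n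
... | inj₂ 2∣p with prime⇒irreducible p-prime 2∣p
...   | inj₁ ()
...   | inj₂ 2≡p = contradiction (sym 2≡p) p≢2

even⇒≡2* : ∀ {a} → 2 ∣ a → ∃[ k ] a ≡ 2 * k
even⇒≡2* (divides k a≡k*2) = k , trans a≡k*2 (*-comm k 2)

≡2*⇒even : ∀ {a} → ∃[ k ] a ≡ 2 * k → 2 ∣ a
≡2*⇒even (k , a≡2*k) = divides k (trans a≡2*k (*-comm 2 k))

pigeonhole-ℕ : ∀ {m n} → m < n → (f : Fin n → ℕ) → (∀ i → f i < m) →
               ∃₂ λ i j → toℕ i < toℕ j × f i ≡ f j
pigeonhole-ℕ m<n f f<m =
  let i , j , i<j , same = pigeonhole m<n (λ i → fromℕ< (f<m i))
  in  i , j , i<j , trans (sym (toℕ-fromℕ< (f<m i))) (trans (cong toℕ same) (toℕ-fromℕ< (f<m j)))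

¬coprime⇒1<gcd : ∀ {c n} .{{_ : NonZero n}} → ¬ Coprime c n → 1 < gcd c n
¬coprime⇒1<gcd {c} {n} ¬c⊥n with gcd c n in eq
... | zero        = contradiction eq (gcd[m,n]≢0 c n (inj₂ (≢-nonZero⁻¹ n)))
... | suc zero    = ⊥-elim (¬c⊥n (gcd≡1⇒coprime eq))
... | suc (suc _) = s<s z<s

1<gcd⇒¬coprime : ∀ {c n} → 1 < gcd c n → ¬ Coprime c n
1<gcd⇒¬coprime 1<gcd c⊥n = <⇒≢ 1<gcd (sym (coprime⇒gcd≡1 c⊥n))

module Generator (n : ℕ) .{{_ : NonZero n}} (p-prime : Prime (suc n))
                 (g : ℕ) (gen : IsGenerator (suc n) g) where

  private
    p : ℕ
    p = suc n

  1<p : 1 < p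
  1<p = s<s (>-nonZero⁻¹ n)

  unit⇒∤ : ∀ {a} → Unit p a → ¬ p ∣ a
  unit⇒∤ (0<a , a<p) = >⇒∤ {{>-nonZero 0<a}} a<p

  p∤g^ : ∀ k → ¬ p ∣ g ^ k
  p∤g^ zero    = unit⇒∤ (z<s , 1<p)
  p∤g^ (suc k) = [ unit⇒∤ (proj₁ gen) , p∤g^ k ]′ ∘ euclidsLemma g (g ^ k) p-prime

  g^-unit : ∀ k → Unit p (g ^ k % p)
  g^-unit k = n≢0⇒n>0 (p∤g^ k ∘ m%n≡0⇒n∣m (g ^ k) p) , m%n<n (g ^ k) p

  log : ∀ {a} → Unit p a → ℕ
  log {a} u = proj₁ (proj₂ gen a u)

  g^log : ∀ {a} (u : Unit p a) → g ^ log u ≡ a mod p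
  g^log {a} u = trans (proj₂ (proj₂ gen a u)) (sym (m<n⇒m%n≡m (proj₂ u)))

  pred-unit< : ∀ {a} → Unit p a → pred a < n
  pred-unit< {suc a} (_ , s<s a<n) = a<n

  pred-unit-injective : ∀ {a b} → Unit p a → Unit p b → pred a ≡ pred b → a ≡ b
  pred-unit-injective {suc a} {suc b} _ _ = cong suc

  suc-unit : (i : Fin n) → Unit p (suc (toℕ i))
  suc-unit i = z<s , s<s (toℕ<n i)

  order-≥ : ∀ e .{{_ : NonZero e}} → g ^ e ≡ 1 mod p → n ≤ e
  order-≥ e gᵉ≡1 with n ≤? e
  ... | yes n≤e = n≤e
  ... | no  n≰e with pigeonhole-ℕ (≰⇒> n≰e) (λ i → log (suc-unit i) % e) (λ i → m%n<n _ e)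
  ...   | i , j , i<j , same = contradiction (suc-injective (<-≡-mod⇒≡ (proj₂ (suc-unit i)) (proj₂ (suc-unit j)) (begin
    suc (toℕ i) % p                       ≡⟨ g^log (suc-unit i) ⟨
    g ^ log (suc-unit i) % p              ≡⟨ ^-mod-period gᵉ≡1 (log (suc-unit i)) ⟩
    g ^ (log (suc-unit i) % e) % p        ≡⟨ cong (λ r → g ^ r % p) same ⟩
    g ^ (log (suc-unit j) % e) % p        ≡⟨ ^-mod-period gᵉ≡1 (log (suc-unit j)) ⟨
    g ^ log (suc-unit j) % p              ≡⟨ g^log (suc-unit j) ⟩
    suc (toℕ j) % p                       ∎))) (<⇒≢ i<j)
    where open ≡-Reasoning

  ^-≡-mod⇒^∸≡1 : ∀ {a b} → g ^ a ≡ g ^ b mod p → g ^ (b ∸ a) ≡ 1 mod p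
  ^-≡-mod⇒^∸≡1 {a} {b} gᵃ≡gᵇ with ≤-total a b
  ... | inj₂ b≤a rewrite m≤n⇒m∸n≡0 b≤a = refl
  ... | inj₁ a≤b = *-cancelˡ-mod p-prime (p∤g^ a) (begin
    g ^ a * g ^ (b ∸ a) % p  ≡⟨ cong (_% p) (^-distribˡ-+-* g a (b ∸ a)) ⟨
    g ^ (a + (b ∸ a)) % p    ≡⟨ cong (λ k → g ^ k % p) (m+[n∸m]≡n a≤b) ⟩
    g ^ b % p                ≡⟨ gᵃ≡gᵇ ⟨
    g ^ a % p                ≡⟨ cong (_% p) (*-identityʳ (g ^ a)) ⟨
    g ^ a * 1 % p            ∎)
    where open ≡-Reasoning

  ∃-order≤ : ∃[ e ] 0 < e × e ≤ n × g ^ e ≡ 1 mod p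
  ∃-order≤ with pigeonhole-ℕ (n<1+n n) (λ i → pred (g ^ toℕ i % p)) (pred-unit< ∘ g^-unit ∘ toℕ)
  ... | i , j , i<j , same =
    toℕ j ∸ toℕ i , m<n⇒0<n∸m i<j , ≤-trans (m∸n≤m (toℕ j) (toℕ i)) (s≤s⁻¹ (toℕ<n j)) ,
    ^-≡-mod⇒^∸≡1 {toℕ i} {toℕ j} (pred-unit-injective (g^-unit (toℕ i)) (g^-unit (toℕ j)) same)

  g^n≡1 : g ^ n ≡ 1 mod p
  g^n≡1 with ∃-order≤
  ... | e , 0<e , e≤n , gᵉ≡1 = subst (λ e → g ^ e ≡ 1 mod p) (≤-antisym e≤n (order-≥ e {{>-nonZero 0<e}} gᵉ≡1)) gᵉ≡1

  ^≡1⇒∣ : ∀ k → g ^ k ≡ 1 mod p → n ∣ k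
  ^≡1⇒∣ k gᵏ≡1 = m%n≡0⇒n∣m k n (remainder≡0 (k % n) (m%n<n k n) (trans (sym (^-mod-period g^n≡1 k)) gᵏ≡1))
    where
    remainder≡0 : ∀ r → r < n → g ^ r ≡ 1 mod p → r ≡ 0
    remainder≡0 zero    _   _    = refl
    remainder≡0 (suc r) r<n gʳ≡1 = contradiction (order-≥ (suc r) gʳ≡1) (<⇒≱ r<n)

  ^-injective-mod : ∀ {a b} → g ^ a ≡ g ^ b mod p → a ≡ b mod n
  ^-injective-mod {a} {b} gᵃ≡gᵇ = ∣∸⇒≡-mod (^≡1⇒∣ (b ∸ a) (^-≡-mod⇒^∸≡1 {a} gᵃ≡gᵇ)) (^≡1⇒∣ (a ∸ b) (^-≡-mod⇒^∸≡1 {b} (sym gᵃ≡gᵇ)))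

  ^-cong-exp : ∀ {a b} → a ≡ b mod n → g ^ a ≡ g ^ b mod p
  ^-cong-exp = ^-cong-exp-mod g^n≡1

  even⇒QR : ∀ {c} → 2 ∣ c → IsQR p (g ^ c % p)
  even⇒QR (divides j refl) = g^-unit (j * 2) , g ^ j , cong (_% p) (sym (^-double g j))

  root-unit : ∀ {v} y → Unit p v → y * y % p ≡ v → Unit p (y % p)
  root-unit {v} y (0<v , _) y²≡v = n≢0⇒n>0 y%p≢0 , m%n<n y p
    where
    y%p≢0 : y % p ≢ 0
    y%p≢0 y%p≡0 = <⇒≢ 0<v (trans (sym (n∣m⇒m%n≡0 (y * y) p (∣m⇒∣m*n y (m%n≡0⇒n∣m y p y%p≡0)))) y²≡v)

  QR⇒even : 2 ∣ n → ∀ {c} → IsQR p (g ^ c % p) → 2 ∣ c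
  QR⇒even 2∣n {c} (v-unit , y , y²≡gᶜ) =
    ∣-resp-≡-mod 2∣n (^-injective-mod g²ʲ≡gᶜ) (divides j refl)
    where
    y-unit : Unit p (y % p)
    y-unit = root-unit y v-unit y²≡gᶜ
    j : ℕ
    j = log y-unit
    g²ʲ≡gᶜ : g ^ (j * 2) ≡ g ^ c mod p
    g²ʲ≡gᶜ = begin
      g ^ (j * 2) % p      ≡⟨ cong (_% p) (^-double g j) ⟩
      g ^ j * g ^ j % p    ≡⟨ *-cong-mod {a = g ^ j} {y} {g ^ j} {y} gʲ≡y gʲ≡y ⟩
      y * y % p            ≡⟨ y²≡gᶜ ⟩
      g ^ c % p            ∎
      where
      open ≡-Reasoning
      gʲ≡y : g ^ j ≡ y mod p
      gʲ≡y = trans (g^log y-unit) (%-≡-mod y)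

  generator⇒coprime : ∀ {c} → IsGenerator p (g ^ c % p) → Coprime c n
  generator⇒coprime {c} (_ , surjective) (d∣c , d∣n) =
    ∣1⇒≡1 (∣-resp-≡-mod d∣n (^-injective-mod gᶜᵏ≡g¹) (∣m⇒∣m*n k d∣c))
    where
    k : ℕ
    k = proj₁ (surjective g (proj₁ gen))
    gᶜᵏ≡g¹ : g ^ (c * k) ≡ g ^ 1 mod p
    gᶜᵏ≡g¹ = begin
      g ^ (c * k) % p      ≡⟨ cong (_% p) (^-*-assoc g c k) ⟨
      (g ^ c) ^ k % p      ≡⟨ ^-cong-mod (%-≡-mod (g ^ c)) k ⟨
      (g ^ c % p) ^ k % p  ≡⟨ proj₂ (surjective g (proj₁ gen)) ⟩
      g                    ≡⟨ m<n⇒m%n≡m (proj₂ (proj₁ gen)) ⟨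
      g % p                ≡⟨ cong (_% p) (^-identityʳ g) ⟨
      g ^ 1 % p            ∎
      where open ≡-Reasoning

  coprime⇒generator : ∀ {c} → Coprime c n → IsGenerator p (g ^ c % p)
  coprime⇒generator {c} c⊥n = g^-unit c , λ a a-unit →
    let k , gᵏ≡a = proj₂ gen a a-unit
        t , ct≡k = coprime⇒solvable-mod c⊥n k
    in  t , (begin
      (g ^ c % p) ^ t % p  ≡⟨ ^-cong-mod (%-≡-mod (g ^ c)) t ⟩
      (g ^ c) ^ t % p      ≡⟨ cong (_% p) (^-*-assoc g c t) ⟩
      g ^ (c * t) % p      ≡⟨ ^-cong-exp ct≡k ⟩
      g ^ k % p            ≡⟨ gᵏ≡a ⟩
      a                    ∎)
    where open ≡-Reasoning

  module _ (2∣n : 2 ∣ n) where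

    NG⇔ : ∀ {c} → IsNG p (g ^ c % p) ⇔ (¬ 2 ∣ c × ¬ Coprime c n)
    NG⇔ {c} = mk⇔
      (λ (_ , ¬QR , ¬generator) → ¬QR ∘ even⇒QR , ¬generator ∘ coprime⇒generator)
      (λ (odd , ¬c⊥n) → g^-unit c , odd ∘ QR⇒even 2∣n , ¬c⊥n ∘ generator⇒coprime)

    Rbar⇔ : ∀ a x c → a * g ^ x ≡ g ^ c mod p →
            Rbar p a (g ^ x % p) ⇔ (2 ∣ x × ¬ 2 ∣ c × ¬ Coprime c n)
    Rbar⇔ a x c agˣ≡gᶜ = mk⇔
      (λ (QR , NG) → QR⇒even 2∣n QR , Equivalence.to NG⇔ (subst (IsNG p) shift NG))
      (λ (even , rest) → even⇒QR even , subst (IsNG p) (sym shift) (Equivalence.from NG⇔ rest))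
      where
      shift : a * (g ^ x % p) % p ≡ g ^ c % p
      shift = trans (*-cong-mod {a = a} {a} {g ^ x % p} {g ^ x} refl (%-≡-mod (g ^ x))) agˣ≡gᶜ

    NI⇔ : ∀ y → NI p g (g ^ suc y % p) ⇔ (2 ∣ suc y × ¬ Coprime y n × ¬ Coprime (suc y + 1) n)
    NI⇔ y = mk⇔ necessary sufficient
      where
      open ≡-Reasoning
      x : ℕ
      x = suc y

      g-shift : g * g ^ x ≡ g ^ (x + 1) mod p
      g-shift = cong (λ k → g ^ k % p) (+-comm 1 x)

      inverse-shift : ∀ {h} → IsInverse p g h → h * g ^ x ≡ g ^ y mod p
      inverse-shift h-inverse = inverse-cancelˡ-mod {a = g} {b = g ^ y} h-inverse

      g⁻¹ : ℕ
      g⁻¹ = g ^ pred n % p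

      g⁻¹-inverse : IsInverse p g g⁻¹
      g⁻¹-inverse = g^-unit (pred n) , (begin
        g * g⁻¹ % p             ≡⟨ *-cong-mod {a = g} {g} {g⁻¹} {g ^ pred n} refl (%-≡-mod (g ^ pred n)) ⟩
        g ^ suc (pred n) % p    ≡⟨ cong (λ k → g ^ k % p) (suc-pred n) ⟩
        g ^ n % p               ≡⟨ g^n≡1 ⟩
        1 % p                   ≡⟨ m<n⇒m%n≡m 1<p ⟩
        1                       ∎)

      necessary : NI p g (g ^ x % p) → 2 ∣ x × ¬ Coprime y n × ¬ Coprime (x + 1) n
      necessary (Rᵍ , h , h-inverse , Rʰ)
        with Equivalence.to (Rbar⇔ g x (x + 1) g-shift) Rᵍ | Equivalence.to (Rbar⇔ h x y (inverse-shift h-inverse)) Rʰ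
      ... | even , _ , ¬x+1⊥n | _ , _ , ¬y⊥n = even , ¬y⊥n , ¬x+1⊥n

      sufficient : 2 ∣ x × ¬ Coprime y n × ¬ Coprime (x + 1) n → NI p g (g ^ x % p)
      sufficient (even , ¬y⊥n , ¬x+1⊥n) =
        Equivalence.from (Rbar⇔ g x (x + 1) g-shift) (even , even⇒¬even-suc even ∘ subst (2 ∣_) (+-comm x 1) , ¬x+1⊥n) ,
        g⁻¹ , g⁻¹-inverse ,
        Equivalence.from (Rbar⇔ g⁻¹ x y (inverse-shift g⁻¹-inverse)) (even , (λ 2∣y → even⇒¬even-suc 2∣y even) , ¬y⊥n)

lemma2 : (p : ℕ) .{{_ : NonZero p}} → Prime p → p ≢ 2 →
  (g : ℕ) → IsGenerator p g →
  (x : ℕ) → 0 < x → x < p ∸ 1 →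
  (NI p g (g ^ x % p) → B (p ∸ 1) x) × (B (p ∸ 1) x → NI p g (g ^ x % p))
lemma2 zero          p-prime = contradiction p-prime ¬prime[0]
lemma2 (suc zero)    p-prime = contradiction p-prime ¬prime[1]
lemma2 (suc (suc _)) _ _ _ _ zero ()
lemma2 (suc n@(suc _)) p-prime p≢2 g gen (suc y) 0<x x<n =
  (λ ni → let even , ¬y⊥n , ¬x+1⊥n = to ni
          in  0<x , x<n , even⇒≡2* even , ¬coprime⇒1<gcd ¬y⊥n , ¬coprime⇒1<gcd ¬x+1⊥n) ,
  (λ (_ , _ , even , 1<gcd₋ , 1<gcd₊) → from (≡2*⇒even even , 1<gcd⇒¬coprime 1<gcd₋ , 1<gcd⇒¬coprime 1<gcd₊))
  where
  open Generator n p-prime g gen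
  open Equivalence (NI⇔ (odd-prime⇒even-pred p-prime p≢2) y)
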